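{- Let $n\ge 1$ and $\pi\in\mathcal D^1_{2n}(2413,3142)$ with last entry $2k-1$, decomposed into blocks $\pi=\cdots A_i B_i A_{i-1}B_{i-1}\cdots A_1 B_0\,(2k)\,A_0\,(2k-1)$ as described in the context. Then: (1) for every $i\ge 0$, if $a\in A_i$ and $b\in A_{i+1}$, then $a>b$; (2) for every $i\ge 0$, if $a\in B_i$ and $b\in B_{i+1}$, then $a<b$.
   Context: A Dumont permutation of the first kind of length $2n$ is a permutation $\pi$ of $\{1,\dots,2n\}$ such that every even entry is not last and is followed by a smaller entry, and every odd entry is either last or followed by a larger entry. $\mathcal D^1_{2n}(2413,3142)$ is the set of those containing no subsequence order-isomorphic to $2413$ or $3142$. Block decomposition: if the last entry is $2k-1$, let $A_0$ be the (possibly empty) string of entries strictly between $2k$ and the last entry. The prefix of $\pi$ preceding $2k$ consists of entries each either $<2k-1$ or $>2k$; split it into maximal runs of consecutive entries that are all $<2k-1$ ("small runs") or all $>2k$ ("large runs"). If the run immediately preceding $2k$ is large it is called $B_0$, otherwise $B_0$ is empty; moving leftwards, the remaining runs alternate and are named $A_1,B_1,A_2,B_2,\dots$, so that $\pi=\cdots A_iB_iA_{i-1}B_{i-1}\cdots A_1B_0(2k)A_0(2k-1)$, where each $A_i$ ($i\ge1$) consists of entries $<2k-1$, each $B_i$ of entries $>2k$, and the blocks $A_1,B_1,\dots$ that occur are nonempty. -}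

module Defs where

open import Data.Nat using (ℕ; zero; suc; _+_; _*_; _∸_; _<_; _<ᵇ_)
open import Data.Nat.Divisibility using (_∣_)
open import Data.Bool using (Bool; true; false; if_then_else_)
open import Data.Bool.Properties using () renaming (_≟_ to _≟ᵇ_)
open import Data.List using (List; []; _∷_; _++_; map; upTo; reverse; [_])
open import Data.List.Relation.Binary.Permutation.Propositional using (_↭_)
open import Data.List.Relation.Binary.Sublist.Propositional using (_⊆_)
open import Data.Product using (_×_; ∃-syntax)
open import Data.Sum using (_⊎_)
open import Data.Unit using (⊤)
open import Relation.Nullary using (¬_; yes; no)

IsPermOf : ℕ → List ℕ → Set
IsPermOf m π = π ↭ map suc (upTo m)

Even Odd : ℕ → Set
Even x = 2 ∣ x
Odd x = ¬ (2 ∣ x)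

DumontCond : List ℕ → Set
DumontCond [] = ⊤
DumontCond (x ∷ []) = Odd x
DumontCond (x ∷ y ∷ rest) = (Even x → y < x) × (Odd x → x < y) × DumontCond (y ∷ rest)

Contains2413 : List ℕ → Set
Contains2413 π = ∃[ a ] ∃[ b ] ∃[ c ] ∃[ d ]
  ((a ∷ b ∷ c ∷ d ∷ []) ⊆ π × c < a × a < d × d < b)

Contains3142 : List ℕ → Set
Contains3142 π = ∃[ a ] ∃[ b ] ∃[ c ] ∃[ d ]
  ((a ∷ b ∷ c ∷ d ∷ []) ⊆ π × b < d × d < a × a < c)

InD1Avoid : ℕ → List ℕ → Set
InD1Avoid n π = IsPermOf (2 * n) π × DumontCond π × ¬ Contains2413 π × ¬ Contains3142 π

runs : (ℕ → Bool) → List ℕ → List (List ℕ)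
runs p [] = []
runs p (x ∷ xs) with runs p xs
... | [] = [ x ∷ [] ]
... | [] ∷ rss = [ x ] ∷ rss
... | (y ∷ ys) ∷ rss with p x ≟ᵇ p y
...   | yes _ = (x ∷ y ∷ ys) ∷ rss
...   | no _ = [ x ] ∷ (y ∷ ys) ∷ rss

large : ℕ → ℕ → Bool
large k x = (2 * k) <ᵇ x

-- Given k and the prefix P preceding 2k, the runs listed from right to left,
-- starting with B₀ (empty if the run immediately before 2k is small or P is empty):
-- B₀, A₁, B₁, A₂, B₂, …
headOr : List ℕ → ℕ
headOr [] = 0
headOr (z ∷ _) = z

prependB₀ : ℕ → List (List ℕ) → List (List ℕ)
prependB₀ k [] = []
prependB₀ k (r ∷ rs) = if large k (headOr r) then r ∷ rs else [] ∷ r ∷ rs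

blockList : ℕ → List ℕ → List (List ℕ)
blockList k P = prependB₀ k (reverse (runs (large k) P))

nthOr : List (List ℕ) → ℕ → List ℕ
nthOr [] _ = []
nthOr (l ∷ ls) zero = l
nthOr (l ∷ ls) (suc j) = nthOr ls j

-- block A_i (A₀ is the string between 2k and the last entry); empty if absent
blockA : ℕ → List ℕ → List ℕ → ℕ → List ℕ
blockA k P A₀ zero = A₀
blockA k P A₀ (suc i) = nthOr (blockList k P) (suc (2 * i))

blockB : ℕ → List ℕ → ℕ → List ℕ
blockB k P i = nthOr (blockList k P) (2 * i)

-- Every entry before 2k is small (< 2k − 1) or large (> 2k), and the blocks
-- alternate between the two kinds, so entries b ∈ A_{i+2}, c ∈ B_{i+1}, a ∈ A_{i+1}
-- (resp. b ∈ B_{i+1}, c ∈ A_{i+1}, a ∈ B_i) occur in the order b c a, followed by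
-- 2k − 1, with c on the other side of 2k − 1 from b. If a and b were in the wrong
-- order, b c a (2k − 1) would be an occurrence of 2413 (resp. 3142). For A₁ against
-- A₀ the entry 2k takes the place of c.
module Submission where

open import Defs
open import Level using (Level)
open import Data.Bool using (Bool; true; false; not; T)
open import Data.Bool.Properties using (not-involutive; ¬-not) renaming (_≟_ to _≟ᵇ_)
open import Data.Empty using (⊥-elim)
open import Data.Unit using (tt)
open import Data.Nat using (ℕ; zero; suc; _*_; _∸_; _<_; _≤_; s≤s)
open import Data.Nat.Properties
  using (<ᵇ⇒<; <⇒<ᵇ; ≮⇒≥; ≤∧≢⇒<; <-cmp; ≤-<-trans; m∸n≤m; n<1+n; *-suc; suc-injective)
open import Data.List using (List; _∷_; []; _++_; [_]; concat; reverse; reverseAcc; drop)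
open import Data.List.Properties using (concat-++; unfold-reverse; reverse-involutive; ++-identityʳ)
open import Data.List.Membership.Propositional using (_∈_)
open import Data.List.Relation.Unary.Any using (here)
open import Data.List.Relation.Unary.All as All using (All; []; _∷_)
open import Data.List.Relation.Unary.AllPairs using (AllPairs; []; _∷_)
open import Data.List.Relation.Unary.Unique.Propositional using (Unique)
open import Data.List.Relation.Unary.Unique.Propositional.Properties using (upTo⁺; map⁺)
open import Data.List.Relation.Binary.Sublist.Propositional
  using (_⊆_; []; _∷_; _∷ʳ_; minimum; from∈; to∈; ⊆-refl; ⊆-trans)
open import Data.List.Relation.Binary.Sublist.Propositional.Properties
  using (All-resp-⊆; ++⁺; ++⁺ˡ; ++⁺ʳ)
open import Data.List.Relation.Binary.Permutation.Propositional using (↭-sym; ↭⇒↭ₛ)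
open import Data.List.Relation.Binary.Permutation.Setoid.Properties using (Unique-resp-↭)
open import Data.Product using (_×_; _,_; proj₂; ∃-syntax)
open import Relation.Binary.Core using (Rel)
open import Relation.Binary.Definitions using (tri<; tri≈; tri>)
open import Relation.Binary.PropositionalEquality
  using (_≡_; _≢_; refl; sym; trans; cong; subst; setoid; module ≡-Reasoning)
open import Relation.Nullary using (¬_; yes; no)

private
  variable
    a ℓ : Level
    A : Set a
    R : Rel A ℓ
    xs ys : List A
    v w : Bool
    i j k x y z t : ℕ
    L : List (List ℕ)

AllPairs-resp-⊆ : xs ⊆ ys → AllPairs R ys → AllPairs R xs
AllPairs-resp-⊆ []         []        = []
AllPairs-resp-⊆ (_ ∷ʳ sub) (_ ∷ rys) = AllPairs-resp-⊆ sub rys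
AllPairs-resp-⊆ (refl ∷ sub) (ry ∷ rys) = All-resp-⊆ sub ry ∷ AllPairs-resp-⊆ sub rys

permutation⇒unique : ∀ {m π} → IsPermOf m π → Unique π
permutation⇒unique {m} perm =
  Unique-resp-↭ (setoid ℕ) (↭⇒↭ₛ (↭-sym perm)) (map⁺ suc-injective (upTo⁺ m))

module _ {π : List ℕ} (π-unique : Unique π) where

  avoids2413⇒< : ¬ Contains2413 π → (x ∷ y ∷ z ∷ t ∷ []) ⊆ π → x < t → t < y → x < z
  avoids2413⇒< {x} {y} {z} {t} avoid sub x<t t<y with <-cmp x z | AllPairs-resp-⊆ sub π-unique
  ... | tri< x<z _ _ | _                   = x<z
  ... | tri≈ _ x≡z _ | (_ ∷ x≢z ∷ _) ∷ _ = ⊥-elim (x≢z x≡z)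
  ... | tri> _ _ z<x | _                   = ⊥-elim (avoid (x , y , z , t , sub , z<x , x<t , t<y))

  avoids3142⇒< : ¬ Contains3142 π → (x ∷ y ∷ z ∷ t ∷ []) ⊆ π → y < t → t < x → z < x
  avoids3142⇒< {x} {y} {z} {t} avoid sub y<t t<x with <-cmp x z | AllPairs-resp-⊆ sub π-unique
  ... | tri< x<z _ _ | _                   = ⊥-elim (avoid (x , y , z , t , sub , y<t , t<x , x<z))
  ... | tri≈ _ x≡z _ | (_ ∷ x≢z ∷ _) ∷ _ = ⊥-elim (x≢z x≡z)
  ... | tri> _ _ z<x | _                   = z<x

-- The blocks of L laid out from right to left, as P = ⋯ A₂ B₁ A₁ B₀.
crev : List (List ℕ) → List ℕ
crev L = concat (reverse L)

crev-∷ : ∀ l L → crev (l ∷ L) ≡ crev L ++ l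
crev-∷ l L = begin
  concat (reverse (l ∷ L))    ≡⟨ cong concat (unfold-reverse l L) ⟩
  concat (reverse L ++ [ l ]) ≡⟨ concat-++ (reverse L) [ l ] ⟨
  crev L ++ (l ++ [])         ≡⟨ cong (crev L ++_) (++-identityʳ l) ⟩
  crev L ++ l                 ∎
  where open ≡-Reasoning

crev-drop : ∀ L j → crev (drop j L) ≡ crev (drop (suc j) L) ++ nthOr L j
crev-drop []      zero    = refl
crev-drop []      (suc j) = refl
crev-drop (l ∷ L) zero    = crev-∷ l L
crev-drop (l ∷ L) (suc j) = crev-drop L j

crev-drop-⊆ : ∀ L j → crev (drop j L) ⊆ crev L
crev-drop-⊆ L       zero    = ⊆-refl
crev-drop-⊆ []      (suc j) = ⊆-refl
crev-drop-⊆ (l ∷ L) (suc j) = subst (_ ⊆_) (sym (crev-∷ l L)) (++⁺ʳ l (crev-drop-⊆ L j))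

∷ʳ-nthOr-⊆ : ∀ L j → xs ⊆ crev (drop (suc j) L) → x ∈ nthOr L j → xs ++ [ x ] ⊆ crev (drop j L)
∷ʳ-nthOr-⊆ L j sub x∈ = subst (_ ⊆_) (sym (crev-drop L j)) (++⁺ sub (from∈ x∈))

∈-nthOr⇒∈-crev : ∀ L j → x ∈ nthOr L j → x ∈ crev L
∈-nthOr⇒∈-crev L j x∈ = to∈ (⊆-trans (∷ʳ-nthOr-⊆ L j (minimum _) x∈) (crev-drop-⊆ L j))

nthOr-consecutive-⊆ : ∀ L j → x ∈ nthOr L (suc (suc j)) → y ∈ nthOr L (suc j) → z ∈ nthOr L j →
                      x ∷ y ∷ z ∷ [] ⊆ crev L
nthOr-consecutive-⊆ L j x∈ y∈ z∈ = ⊆-trans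
  (∷ʳ-nthOr-⊆ L j (∷ʳ-nthOr-⊆ L (suc j) (∷ʳ-nthOr-⊆ L (suc (suc j)) (minimum _) x∈) y∈) z∈)
  (crev-drop-⊆ L j)

data Alternating (p : ℕ → Bool) : Bool → List (List ℕ) → Set where
  []  : Alternating p v []
  _∷_ : ∀ {x xs rs} → All (λ y → p y ≡ v) (x ∷ xs) → Alternating p (not v) rs →
        Alternating p v ((x ∷ xs) ∷ rs)

alternate : Bool → ℕ → Bool
alternate v zero    = v
alternate v (suc j) = alternate (not v) j

alternate-even : ∀ v i → alternate v (2 * i) ≡ v
alternate-even v zero    = refl
alternate-even v (suc i) = begin
  alternate v (2 * suc i)        ≡⟨ cong (alternate v) (*-suc 2 i) ⟩
  alternate (not (not v)) (2 * i) ≡⟨ cong (λ u → alternate u (2 * i)) (not-involutive v) ⟩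
  alternate v (2 * i)            ≡⟨ alternate-even v i ⟩
  v                              ∎
  where open ≡-Reasoning

module _ {p : ℕ → Bool} where

  ∈-nthOr-alternating : Alternating p v L → ∀ j → x ∈ nthOr L j → p x ≡ alternate v j
  ∈-nthOr-alternating (run ∷ _)   zero    x∈ = All.lookup run x∈
  ∈-nthOr-alternating (_ ∷ rest) (suc j) x∈ = ∈-nthOr-alternating rest j x∈

  nthOr-inhabited : Alternating p v L → ∀ j → x ∈ nthOr L (suc j) → ∃[ y ] y ∈ nthOr L j
  nthOr-inhabited (_∷_ {x = y} _ _) zero    _  = y , here refl
  nthOr-inhabited (_ ∷ rest)         (suc j) x∈ = nthOr-inhabited rest j x∈

  runs-alternating : ∀ xs → ∃[ v ] Alternating p v (runs p xs)
  runs-alternating []       = true , []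
  runs-alternating (x ∷ xs) with runs p xs | runs-alternating xs
  ... | []            | _              = p x , (refl ∷ []) ∷ []
  ... | (y ∷ ys) ∷ rs | v , run ∷ rest with p x ≟ᵇ p y
  ...   | yes px≡py = v , (trans px≡py (All.head run) ∷ run) ∷ rest
  ...   | no  px≢py = p x , (refl ∷ []) ∷ subst (λ u → Alternating p u _) v≡¬px (run ∷ rest)
    where
    v≡¬px : v ≡ not (p x)
    v≡¬px = trans (sym (All.head run)) (¬-not (λ py≡px → px≢py (sym py≡px)))

  concat-runs : ∀ xs → concat (runs p xs) ≡ xs
  concat-runs []       = refl
  concat-runs (x ∷ xs) with runs p xs | concat-runs xs
  ... | []            | eq = cong (x ∷_) eq
  ... | [] ∷ rs       | eq = cong (x ∷_) eq
  ... | (y ∷ ys) ∷ rs | eq with p x ≟ᵇ p y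
  ...   | yes _ = cong (x ∷_) eq
  ...   | no  _ = cong (x ∷_) eq

  reverseAcc-alternating : ∀ {acc} → Alternating p (not v) acc → Alternating p v L →
                           ∃[ w ] Alternating p w (reverseAcc acc L)
  reverseAcc-alternating         acc []           = _ , acc
  reverseAcc-alternating {v = v} acc (run ∷ rest) = reverseAcc-alternating
    (subst (λ u → Alternating p u _) (sym (not-involutive v)) (run ∷ acc)) rest

  reverse-alternating : Alternating p v L → ∃[ w ] Alternating p w (reverse L)
  reverse-alternating = reverseAcc-alternating []

crev-prependB₀ : ∀ k L → crev (prependB₀ k L) ≡ crev L
crev-prependB₀ k []      = refl
crev-prependB₀ k (r ∷ L) with large k (headOr r)
... | true  = refl
... | false = trans (crev-∷ [] (r ∷ L)) (++-identityʳ _)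

crev-blockList : ∀ k P → crev (blockList k P) ≡ P
crev-blockList k P = begin
  crev (blockList k P)          ≡⟨ crev-prependB₀ k (reverse rs) ⟩
  concat (reverse (reverse rs)) ≡⟨ cong concat (reverse-involutive rs) ⟩
  concat rs                     ≡⟨ concat-runs P ⟩
  P                             ∎
  where
  open ≡-Reasoning
  rs : List (List ℕ)
  rs = runs (large k) P

prependB₀-large : Alternating (large k) w L → ∀ j → x ∈ nthOr (prependB₀ k L) j →
                  large k x ≡ alternate true j
prependB₀-large {k} (_∷_ {x = x₀} run rest) j x∈ with large k x₀ | All.head run
... | true  | refl = ∈-nthOr-alternating (run ∷ rest) j x∈
prependB₀-large (run ∷ rest) (suc j) x∈ | false | refl =
  ∈-nthOr-alternating (run ∷ rest) j x∈

prependB₀-inhabited : Alternating (large k) w L →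
                      ∀ j → x ∈ nthOr (prependB₀ k L) (suc (suc j)) → ∃[ y ] y ∈ nthOr (prependB₀ k L) (suc j)
prependB₀-inhabited {k} (_∷_ {x = x₀} run rest) j x∈ with large k x₀ | All.head run
... | true  | refl = nthOr-inhabited (run ∷ rest) (suc j) x∈
... | false | refl = nthOr-inhabited (run ∷ rest) j x∈

module Blocks (k : ℕ) (P A₀ : List ℕ) where

  private
    runs-reversed : ∃[ w ] Alternating (large k) w (reverse (runs (large k) P))
    runs-reversed = let _ , alt = runs-alternating P in reverse-alternating alt

  blockList-large : ∀ j → x ∈ nthOr (blockList k P) j → large k x ≡ alternate true j
  blockList-large = prependB₀-large (proj₂ runs-reversed)

  blockB-large : ∀ i → x ∈ blockB k P i → large k x ≡ true
  blockB-large i x∈ = trans (blockList-large (2 * i) x∈) (alternate-even true i)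

  blockA-small : ∀ i → x ∈ blockA k P A₀ (suc i) → large k x ≡ false
  blockA-small i x∈ = trans (blockList-large (suc (2 * i)) x∈) (alternate-even false i)

  blockA-inhabited : ∀ i → x ∈ blockA k P A₀ (suc (suc i)) → ∃[ y ] y ∈ blockB k P (suc i)
  blockA-inhabited i x∈ rewrite *-suc 2 i =
    prependB₀-inhabited (proj₂ runs-reversed) (suc (2 * i)) x∈

  blockB-inhabited : ∀ i → x ∈ blockB k P (suc i) → ∃[ y ] y ∈ blockA k P A₀ (suc i)
  blockB-inhabited i x∈ rewrite *-suc 2 i =
    prependB₀-inhabited (proj₂ runs-reversed) (2 * i) x∈

  ∈-blockList⇒∈ : x ∈ nthOr (blockList k P) j → x ∈ P
  ∈-blockList⇒∈ {j = j} x∈ =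
    subst (_ ∈_) (crev-blockList k P) (∈-nthOr⇒∈-crev (blockList k P) j x∈)

  blockList-consecutive-⊆ : ∀ j → x ∈ nthOr (blockList k P) (suc (suc j)) →
    y ∈ nthOr (blockList k P) (suc j) → z ∈ nthOr (blockList k P) j → x ∷ y ∷ z ∷ [] ⊆ P
  blockList-consecutive-⊆ j x∈ y∈ z∈ =
    subst (_ ⊆_) (crev-blockList k P) (nthOr-consecutive-⊆ (blockList k P) j x∈ y∈ z∈)

  blockA-ordered : ∀ i → z ∈ blockA k P A₀ (suc i) → y ∈ blockB k P (suc i) →
                   x ∈ blockA k P A₀ (suc (suc i)) → x ∷ y ∷ z ∷ [] ⊆ P
  blockA-ordered i z∈ y∈ x∈ rewrite *-suc 2 i =
    blockList-consecutive-⊆ (suc (2 * i)) x∈ y∈ z∈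

  blockB-ordered : ∀ i → z ∈ blockB k P i → y ∈ blockA k P A₀ (suc i) →
                   x ∈ blockB k P (suc i) → x ∷ y ∷ z ∷ [] ⊆ P
  blockB-ordered i z∈ y∈ x∈ rewrite *-suc 2 i =
    blockList-consecutive-⊆ (2 * i) x∈ y∈ z∈

large⇒2k< : ∀ k → large k x ≡ true → 2 * k < x
large⇒2k< {x} k eq = <ᵇ⇒< (2 * k) x (subst T (sym eq) tt)

¬large⇒≤2k : ∀ k → large k x ≡ false → x ≤ 2 * k
¬large⇒≤2k k eq = ≮⇒≥ (λ 2k<x → subst T eq (<⇒<ᵇ 2k<x))

<∧≢⇒<∸1 : ∀ {m} → x < m → x ≢ m ∸ 1 → x < m ∸ 1
<∧≢⇒<∸1 {m = suc m} (s≤s x≤m) x≢m = ≤∧≢⇒< x≤m x≢m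

m≢m∸1⇒m∸1<m : ∀ m → m ≢ m ∸ 1 → m ∸ 1 < m
m≢m∸1⇒m∸1<m zero    m≢m = ⊥-elim (m≢m refl)
m≢m∸1⇒m∸1<m (suc m) _   = n<1+n m

module _ {k : ℕ} {P A₀ : List ℕ} where

  private
    π : List ℕ
    π = P ++ 2 * k ∷ A₀ ++ [ 2 * k ∸ 1 ]

  module _ (π-unique : Unique π) where

    open Blocks k P A₀

    prefix-⊆ : xs ⊆ P → xs ++ [ 2 * k ∸ 1 ] ⊆ π
    prefix-⊆ sub = ++⁺ sub (2 * k ∷ʳ ++⁺ˡ A₀ ⊆-refl)

    2k∸1<2k : 2 * k ∸ 1 < 2 * k
    2k∸1<2k with AllPairs-resp-⊆ (++⁺ˡ P (refl ∷ ++⁺ˡ A₀ ⊆-refl)) π-unique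
    ... | (2k≢2k∸1 ∷ []) ∷ _ = m≢m∸1⇒m∸1<m (2 * k) 2k≢2k∸1

    small⇒<2k∸1 : x ∈ P → large k x ≡ false → x < 2 * k ∸ 1
    small⇒<2k∸1 x∈ eq with AllPairs-resp-⊆ (++⁺ (from∈ x∈) (refl ∷ ++⁺ˡ A₀ ⊆-refl)) π-unique
    ... | (x≢2k ∷ x≢2k∸1 ∷ []) ∷ _ = <∧≢⇒<∸1 (≤∧≢⇒< (¬large⇒≤2k k eq) x≢2k) x≢2k∸1

    large⇒2k∸1< : large k x ≡ true → 2 * k ∸ 1 < x
    large⇒2k∸1< eq = ≤-<-trans (m∸n≤m (2 * k) 1) (large⇒2k< k eq)

    blockA-decreasing : ¬ Contains2413 π →
      (i a b : ℕ) → a ∈ blockA k P A₀ i → b ∈ blockA k P A₀ (suc i) → b < a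
    blockA-decreasing avoid zero a b a∈ b∈ = avoids2413⇒< π-unique avoid
      (++⁺ (from∈ (∈-blockList⇒∈ b∈)) (refl ∷ ++⁺ (from∈ a∈) ⊆-refl))
      (small⇒<2k∸1 (∈-blockList⇒∈ b∈) (blockA-small 0 b∈)) 2k∸1<2k
    blockA-decreasing avoid (suc i) a b a∈ b∈ =
      let c , c∈ = blockA-inhabited i b∈ in
      avoids2413⇒< π-unique avoid (prefix-⊆ (blockA-ordered i a∈ c∈ b∈))
        (small⇒<2k∸1 (∈-blockList⇒∈ b∈) (blockA-small (suc i) b∈))
        (large⇒2k∸1< (blockB-large (suc i) c∈))

    blockB-increasing : ¬ Contains3142 π →
      (i a b : ℕ) → a ∈ blockB k P i → b ∈ blockB k P (suc i) → a < b
    blockB-increasing avoid i a b a∈ b∈ =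
      let c , c∈ = blockB-inhabited i b∈ in
      avoids3142⇒< π-unique avoid (prefix-⊆ (blockB-ordered i a∈ c∈ b∈))
        (small⇒<2k∸1 (∈-blockList⇒∈ c∈) (blockA-small i c∈))
        (large⇒2k∸1< (blockB-large (suc i) b∈))

lemma2 : (n : ℕ) → 1 ≤ n → (π : List ℕ) → InD1Avoid n π →
    (k : ℕ) (P A₀ : List ℕ) → π ≡ P ++ (2 * k ∷ A₀ ++ (2 * k ∸ 1 ∷ [])) →
    ((i a b : ℕ) → a ∈ blockA k P A₀ i → b ∈ blockA k P A₀ (suc i) → b < a)
    × ((i a b : ℕ) → a ∈ blockB k P i → b ∈ blockB k P (suc i) → a < b)
lemma2 n _ π (perm , _ , avoid2413 , avoid3142) k P A₀ refl =
  blockA-decreasing π-unique avoid2413 , blockB-increasing π-unique avoid3142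
  where
  π-unique : Unique π
  π-unique = permutation⇒unique perm
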